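{- Let $A$ be a valise $(4,1)$ adinkra. Then for any distinct colors $I\neq J$: (1) if $\{K,L\}=\{1,2,3,4\}\setminus\{I,J\}$, then $\phi_{IJ}\phi_{KL}=\phi_{KL}\phi_{IJ}$; (2) $\phi_{1234}=-\phi_{1324}=\phi_{1423}=\begin{bmatrix}-\chi_0(A)\mathbb{1}_4&0\\0&\chi_0(A)\mathbb{1}_4\end{bmatrix}$; (3) $\phi_{12}=\begin{bmatrix}\chi_0(A)(\phi_{34})|_F&0\\0&-\chi_0(A)(\phi_{34})|_B\end{bmatrix}$; (4) $\phi_{13}=\begin{bmatrix}-\chi_0(A)(\phi_{24})|_F&0\\0&\chi_0(A)(\phi_{24})|_B\end{bmatrix}$; (5) $\phi_{14}=\begin{bmatrix}\chi_0(A)(\phi_{23})|_F&0\\0&-\chi_0(A)(\phi_{23})|_B\end{bmatrix}$.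
   Context: Vertices: bosons $B=\{b_1,\dots,b_4\}$, fermions $F=\{f_1,\dots,f_4\}$. A valise $(4,1)$ adinkra is $K_{4,4}$ between $B$ and $F$ with edges colored by $\{1,2,3,4\}$ (each vertex has one edge of each color; any two colors form a disjoint union of $4$-cycles) and an odd dashing (every two-colored $4$-cycle has an odd number of dashed edges). For color $I$, $L_I$ is the $4\times4$ matrix (rows bosons, columns fermions) with $(i,j)$ entry $+1$/$-1$ if $b_i,f_j$ are joined by a solid/dashed edge of color $I$, else $0$; $R_I=L_I^T$; with basis ordered fermions first, $\phi_I=\begin{bmatrix}0&R_I\\L_I&0\end{bmatrix}$, and $\phi_{I_1\cdots I_s}=\phi_{I_1}\cdots\phi_{I_s}$. For a block-diagonal operator, $(\cdot)|_F$ and $(\cdot)|_B$ denote its fermionic (upper-left) and bosonic (lower-right) $4\times4$ blocks. The chirality $\chi_0(A)\in\{\pm1\}$ is the sign with $\phi_{1234}=\begin{bmatrix}-\chi_0(A)\mathbb{1}_4&0\\0&\chi_0(A)\mathbb{1}_4\end{bmatrix}$. -}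

module Defs where

open import Data.Nat using (ℕ; zero; suc)
open import Data.Fin using (Fin; zero; suc; _≟_)
open import Data.Bool using (Bool; true; false; _xor_; if_then_else_)
open import Data.Integer using (ℤ; +_; -_; _+_; _*_; -1ℤ; 1ℤ; 0ℤ)
open import Data.Sum using (_⊎_; inj₁; inj₂)
open import Relation.Nullary using (yes; no; ¬_)
open import Relation.Binary.PropositionalEquality using (_≡_)
open import Function.Definitions using (Bijective)

-- Colors 1,2,3,4 of the paper are  zero, suc zero, ... : Fin 4.
-- Bosons b_1..b_4 and fermions f_1..f_4 are indexed by Fin 4.
Color : Set
Color = Fin 4

Boson : Set
Boson = Fin 4

Fermion : Set
Fermion = Fin 4

-- A valise (4,1) adinkra: the complete bipartite graph K_{4,4} between
-- bosons and fermions, each edge (b , f) carrying a color  col b f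
-- and a dashing bit  dashed b f  (true = dashed, false = solid).
record Valise41 : Set where
  field
    col    : Boson → Fermion → Color
    dashed : Boson → Fermion → Bool
    boson-colors   : ∀ (b : Boson) → Bijective _≡_ _≡_ (λ f → col b f)
    fermion-colors : ∀ (f : Fermion) → Bijective _≡_ _≡_ (λ b → col b f)
    -- any two distinct colors form a disjoint union of 4-cycles:
    -- the walk b -I- f₁ -J- b' -I- f₂ -J- b'' closes up (b'' = b)
    two-color-4cycles :
      ∀ (I J : Color) → ¬ (I ≡ J) →
      ∀ (b : Boson) (f₁ : Fermion) (b' : Boson) (f₂ : Fermion) (b'' : Boson) →
      col b f₁ ≡ I → col b' f₁ ≡ J → col b' f₂ ≡ I → col b'' f₂ ≡ J → b'' ≡ b
    odd-dashing :
      ∀ (I J : Color) → ¬ (I ≡ J) →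
      ∀ (b : Boson) (f₁ : Fermion) (b' : Boson) (f₂ : Fermion) →
      col b f₁ ≡ I → col b' f₁ ≡ J → col b' f₂ ≡ I → col b f₂ ≡ J →
      (dashed b f₁ xor dashed b' f₁ xor dashed b' f₂ xor dashed b f₂) ≡ true

∑ : (n : ℕ) → (Fin n → ℤ) → ℤ
∑ zero    g = 0ℤ
∑ (suc n) g = g zero + ∑ n (λ i → g (suc i))

Mat4 : Set
Mat4 = Fin 4 → Fin 4 → ℤ

Idx : Set
Idx = Fermion ⊎ Boson

Mat8 : Set
Mat8 = Idx → Idx → ℤ

_·_ : Mat8 → Mat8 → Mat8
(M · N) i k = ∑ 4 (λ f → M i (inj₁ f) * N (inj₁ f) k)
            + ∑ 4 (λ b → M i (inj₂ b) * N (inj₂ b) k)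
infixl 7 _·_

_≋_ : Mat8 → Mat8 → Set
M ≋ N = ∀ i j → M i j ≡ N i j
infix 4 _≋_

neg : Mat8 → Mat8
neg M i j = - M i j

blockDiag : Mat4 → Mat4 → Mat8
blockDiag P Q (inj₁ i) (inj₁ j) = P i j
blockDiag P Q (inj₁ i) (inj₂ j) = 0ℤ
blockDiag P Q (inj₂ i) (inj₁ j) = 0ℤ
blockDiag P Q (inj₂ i) (inj₂ j) = Q i j

_|F : Mat8 → Mat4
(M |F) i j = M (inj₁ i) (inj₁ j)

_|B : Mat8 → Mat4
(M |B) i j = M (inj₂ i) (inj₂ j)

scale4 : ℤ → Mat4 → Mat4
scale4 c P i j = c * P i j

id4 : Mat4
id4 i j with i ≟ j
... | yes _ = 1ℤ
... | no  _ = 0ℤ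

module _ (A : Valise41) where
  open Valise41 A

  sign : Bool → ℤ
  sign true  = -1ℤ
  sign false = 1ℤ

  L : Color → Mat4
  L I b f with col b f ≟ I
  ... | yes _ = sign (dashed b f)
  ... | no  _ = 0ℤ

  R : Color → Mat4
  R I f b = L I b f

  φ : Color → Mat8
  φ I (inj₁ f) (inj₁ f') = 0ℤ
  φ I (inj₁ f) (inj₂ b)  = R I f b
  φ I (inj₂ b) (inj₁ f)  = L I b f
  φ I (inj₂ b) (inj₂ b') = 0ℤ

  φ₂ : Color → Color → Mat8
  φ₂ I J = φ I · φ J

  φ₄ : Color → Color → Color → Color → Mat8
  φ₄ I J K L' = φ I · φ J · φ K · φ L'

  -- chirality χ₀(A): the sign with φ_1234 = diag(-χ₀ 𝟙, χ₀ 𝟙);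
  -- read off as the (b₁,b₁) entry of φ_1234
  χ₀ : ℤ
  χ₀ = φ₄ zero (suc zero) (suc (suc zero)) (suc (suc (suc zero)))
          (inj₂ zero) (inj₂ zero)

-- Each φ_I is a signed permutation matrix: column k has a single entry ±1, in the row of the
-- vertex joined to k by the edge of colour I, signed by the dashing of that edge.  So a product
-- φ_{I₁⋯Iₛ} is the signed permutation obtained by walking from k along the colours Iₛ, …, I₁ and
-- counting dashed edges mod 2.  The 4-cycle and odd-dashing axioms are then exactly the Clifford
-- relations φ_I² = 1 and φ_I φ_J = -φ_J φ_I (I ≠ J), and (1) as well as the sign relations of
-- (2)-(5) become rewriting of words.  What the Clifford relations do not give is that φ₁₂₃₄ is
-- diagonal: the walk along 4, 3, 2, 1 returns to its start, because the bosons reached from b via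
-- the colour pairs {3,4} and {1,2} coincide.  Since φ₁₂₃₄ anticommutes with every φ_I, which
-- exchanges bosons and fermions, and any two bosons are two edges apart, its diagonal is χ₀ on
-- bosons and -χ₀ on fermions; (3)-(5) follow from φ₁₂ = -φ₁₂₃₄φ₃₄, φ₁₃ = φ₁₂₃₄φ₂₄, φ₁₄ = -φ₁₂₃₄φ₂₃.

module Submission where

open import Defs
open import Data.Fin using (Fin; zero; suc; _≟_)
open import Data.Fin.Properties using (suc-injective)
open import Data.Integer using (ℤ; -_; 1ℤ; -1ℤ; 0ℤ; _+_; _*_)
open import Data.Integer.Properties
  using (*-assoc; *-comm; *-identityˡ; *-identityʳ; *-zeroʳ; +-identityˡ; +-identityʳ;
         neg-involutive; neg-distribˡ-*; neg-distribʳ-*)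
open import Data.Nat using (ℕ)
open import Data.Bool using (Bool; true; false; not; _xor_)
open import Data.Bool.Properties using (xor-assoc; xor-identityʳ; not-involutive)
open import Data.Bool.Solver using (module xor-∧-Solver)
open xor-∧-Solver using (solve; _:+_; _:=_; con)
open import Data.List using (List; []; _∷_; _++_)
open import Data.Product using (_×_; _,_; proj₁; proj₂)
open import Data.Sum using (_⊎_; inj₁; inj₂)
open import Function using (_∘_)
open import Level using (0ℓ)
open import Relation.Binary.Bundles using (Setoid)
import Relation.Binary.Reasoning.Setoid as SetoidReasoning
open import Relation.Nullary using (¬_; yes; no; does)
open import Relation.Nullary.Negation using (contradiction)
open import Relation.Binary.PropositionalEquality
  using (_≡_; _≢_; refl; sym; trans; cong; cong₂; subst; module ≡-Reasoning)

∑-cong : ∀ n {g h : Fin n → ℤ} → (∀ i → g i ≡ h i) → ∑ n g ≡ ∑ n h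
∑-cong ℕ.zero    g≡h = refl
∑-cong (ℕ.suc n) g≡h = cong₂ _+_ (g≡h zero) (∑-cong n (g≡h ∘ suc))

∑-zero : ∀ n {g : Fin n → ℤ} → (∀ i → g i ≡ 0ℤ) → ∑ n g ≡ 0ℤ
∑-zero ℕ.zero    g≡0 = refl
∑-zero (ℕ.suc n) g≡0 = cong₂ _+_ (g≡0 zero) (∑-zero n (g≡0 ∘ suc))

∑-single : ∀ {n} (g : Fin n → ℤ) j → (∀ i → i ≢ j → g i ≡ 0ℤ) → ∑ n g ≡ g j
∑-single {ℕ.suc n} g zero    g≡0 =
  trans (cong (g zero +_) (∑-zero n (λ i → g≡0 (suc i) λ ()))) (+-identityʳ (g zero))
∑-single {ℕ.suc n} g (suc j) g≡0 =
  trans (cong₂ _+_ (g≡0 zero λ ()) (∑-single (g ∘ suc) j λ i i≢j → g≡0 (suc i) (i≢j ∘ suc-injective)))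
        (+-identityˡ (g (suc j)))

id4-diag : ∀ i → id4 i i ≡ 1ℤ
id4-diag i with i ≟ i
... | yes _   = refl
... | no  i≢i = contradiction refl i≢i

id4-off : ∀ {i j} → i ≢ j → id4 i j ≡ 0ℤ
id4-off {i} {j} i≢j with i ≟ j
... | yes i≡j = contradiction i≡j i≢j
... | no  _   = refl

id4-select : ∀ (g : Fin 4 → ℤ) {i j} → i ≡ j → g i ≡ id4 i j * g j
id4-select g {i} refl = sym (trans (cong (_* g i) (id4-diag i)) (*-identityˡ (g i)))

row-select : ∀ a (g : Fin 4 → ℤ) i → ∑ 4 (λ j → a * id4 i j * g j) ≡ a * g i
row-select a g i =
  trans (∑-single _ i off) (trans (cong (λ e → a * e * g i) (id4-diag i)) (cong (_* g i) (*-identityʳ a)))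
  where
    off : ∀ j → j ≢ i → a * id4 i j * g j ≡ 0ℤ
    off j j≢i = trans (cong (λ e → a * e * g j) (id4-off (j≢i ∘ sym))) (cong (_* g j) (*-zeroʳ a))

column-select : ∀ (g : Fin 4 → ℤ) j c → ∑ 4 (λ i → g i * (id4 i j * c)) ≡ g j * c
column-select g j c =
  trans (∑-single _ j off) (trans (cong (λ e → g j * (e * c)) (id4-diag j)) (cong (g j *_) (*-identityˡ c)))
  where
    off : ∀ i → i ≢ j → g i * (id4 i j * c) ≡ 0ℤ
    off i i≢j = trans (cong (λ e → g i * (e * c)) (id4-off i≢j)) (*-zeroʳ (g i))

≋-setoid : Setoid 0ℓ 0ℓ
≋-setoid = record
  { Carrier       = Mat8
  ; _≈_           = _≋_
  ; isEquivalence = record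
    { refl  = λ i j → refl
    ; sym   = λ M≋N i j → sym (M≋N i j)
    ; trans = λ M≋N N≋P i j → trans (M≋N i j) (N≋P i j)
    }
  }

open Setoid ≋-setoid using () renaming (refl to ≋-refl; trans to ≋-trans)

·-cong : ∀ {M M′ N N′} → M ≋ M′ → N ≋ N′ → M · N ≋ M′ · N′
·-cong M≋M′ N≋N′ i k =
  cong₂ _+_ (∑-cong 4 λ f → cong₂ _*_ (M≋M′ i (inj₁ f)) (N≋N′ (inj₁ f) k))
            (∑-cong 4 λ b → cong₂ _*_ (M≋M′ i (inj₂ b)) (N≋N′ (inj₂ b) k))

neg-cong : ∀ {M N} → M ≋ N → neg M ≋ neg N
neg-cong M≋N i j = cong -_ (M≋N i j)

δ : Idx → Idx → ℤ
δ (inj₁ i) (inj₁ j) = id4 i j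
δ (inj₁ i) (inj₂ j) = 0ℤ
δ (inj₂ i) (inj₁ j) = 0ℤ
δ (inj₂ i) (inj₂ j) = id4 i j

monomial : (Idx → Idx) → (Idx → ℤ) → Mat8
monomial π v x k = δ x (π k) * v k

monomial-cong : ∀ {π π′ v v′} → (∀ k → π k ≡ π′ k) → (∀ k → v k ≡ v′ k) →
                monomial π v ≋ monomial π′ v′
monomial-cong π≡π′ v≡v′ x k = cong₂ (λ y c → δ x y * c) (π≡π′ k) (v≡v′ k)

monomial-neg : ∀ π v → monomial π (λ k → - v k) ≋ neg (monomial π v)
monomial-neg π v x k = sym (neg-distribʳ-* (δ x (π k)) (v k))

·-monomialʳ : ∀ M ρ w x k → (M · monomial ρ w) x k ≡ M x (ρ k) * w k
·-monomialʳ M ρ w x k = select (M x) (ρ k) (w k)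
  where
    select : ∀ (g : Idx → ℤ) y c →
             ∑ 4 (λ f → g (inj₁ f) * (δ (inj₁ f) y * c)) + ∑ 4 (λ b → g (inj₂ b) * (δ (inj₂ b) y * c))
             ≡ g y * c
    select g (inj₁ j) c =
      trans (cong₂ _+_ (column-select (g ∘ inj₁) j c) (∑-zero 4 λ b → *-zeroʳ (g (inj₂ b))))
            (+-identityʳ (g (inj₁ j) * c))
    select g (inj₂ j) c =
      trans (cong₂ _+_ (∑-zero 4 λ f → *-zeroʳ (g (inj₁ f))) (column-select (g ∘ inj₂) j c))
            (+-identityˡ (g (inj₂ j) * c))

·-monomial : ∀ {M N π v ρ w} → M ≋ monomial π v → N ≋ monomial ρ w →
             M · N ≋ monomial (π ∘ ρ) (λ k → v (ρ k) * w k)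
·-monomial {M} {N} {π} {v} {ρ} {w} M≋ N≋ x k = begin
  (M · N) x k                          ≡⟨ ·-cong {M} {M} {N} {monomial ρ w} ≋-refl N≋ x k ⟩
  (M · monomial ρ w) x k               ≡⟨ ·-monomialʳ M ρ w x k ⟩
  M x (ρ k) * w k                      ≡⟨ cong (_* w k) (M≋ x (ρ k)) ⟩
  δ x (π (ρ k)) * v (ρ k) * w k        ≡⟨ *-assoc (δ x (π (ρ k))) (v (ρ k)) (w k) ⟩
  δ x (π (ρ k)) * (v (ρ k) * w k)      ∎
  where open ≡-Reasoning

monomial-blockDiag : ∀ {π v} a b → (∀ k → π k ≡ k) →
                     (∀ f → v (inj₁ f) ≡ a) → (∀ c → v (inj₂ c) ≡ b) →
                     monomial π v ≋ blockDiag (scale4 a id4) (scale4 b id4)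
monomial-blockDiag {π} {v} a b π≡id va vb = entry
  where
    on-diagonal : ∀ x k → monomial π v x k ≡ δ x k * v k
    on-diagonal x k = cong (λ y → δ x y * v k) (π≡id k)
    entry : monomial π v ≋ blockDiag (scale4 a id4) (scale4 b id4)
    entry (inj₁ i) (inj₁ j) =
      trans (on-diagonal (inj₁ i) (inj₁ j)) (trans (cong (id4 i j *_) (va j)) (*-comm (id4 i j) a))
    entry (inj₁ i) (inj₂ j) = on-diagonal (inj₁ i) (inj₂ j)
    entry (inj₂ i) (inj₁ j) = on-diagonal (inj₂ i) (inj₁ j)
    entry (inj₂ i) (inj₂ j) =
      trans (on-diagonal (inj₂ i) (inj₂ j)) (trans (cong (id4 i j *_) (vb j)) (*-comm (id4 i j) b))

IsEven : Mat8 → Set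
IsEven M = (∀ i j → M (inj₁ i) (inj₂ j) ≡ 0ℤ) × (∀ i j → M (inj₂ i) (inj₁ j) ≡ 0ℤ)

scaleBlocks : ℤ → ℤ → Mat8 → Mat8
scaleBlocks a b M = blockDiag (scale4 a (M |F)) (scale4 b (M |B))

blockDiag-scalar-· : ∀ a b M → IsEven M →
                     blockDiag (scale4 a id4) (scale4 b id4) · M ≋ scaleBlocks a b M
blockDiag-scalar-· a b M (M₁₂≡0 , M₂₁≡0) = entry
  where
    Γ = blockDiag (scale4 a id4) (scale4 b id4)
    -- the zero block of Γ contributes a sum of literal 0ℤ * _, which reduces to 0ℤ
    row₁ : ∀ i k → (Γ · M) (inj₁ i) k ≡ a * M (inj₁ i) k
    row₁ i k = trans (+-identityʳ _) (row-select a (λ f → M (inj₁ f) k) i)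
    row₂ : ∀ i k → (Γ · M) (inj₂ i) k ≡ b * M (inj₂ i) k
    row₂ i k = trans (+-identityˡ _) (row-select b (λ c → M (inj₂ c) k) i)
    entry : Γ · M ≋ scaleBlocks a b M
    entry (inj₁ i) (inj₁ j) = row₁ i (inj₁ j)
    entry (inj₁ i) (inj₂ j) = trans (row₁ i (inj₂ j)) (trans (cong (a *_) (M₁₂≡0 i j)) (*-zeroʳ a))
    entry (inj₂ i) (inj₁ j) = trans (row₂ i (inj₁ j)) (trans (cong (b *_) (M₂₁≡0 i j)) (*-zeroʳ b))
    entry (inj₂ i) (inj₂ j) = row₂ i (inj₂ j)

neg-scaleBlocks : ∀ a b M → neg (scaleBlocks (- a) b M) ≋ scaleBlocks a (- b) M
neg-scaleBlocks a b M (inj₁ i) (inj₁ j) =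
  trans (neg-distribˡ-* (- a) (M (inj₁ i) (inj₁ j))) (cong (_* M (inj₁ i) (inj₁ j)) (neg-involutive a))
neg-scaleBlocks a b M (inj₁ i) (inj₂ j) = refl
neg-scaleBlocks a b M (inj₂ i) (inj₁ j) = refl
neg-scaleBlocks a b M (inj₂ i) (inj₂ j) = neg-distribˡ-* b (M (inj₂ i) (inj₂ j))

xor-leftComm : ∀ x y z → x xor (y xor z) ≡ y xor (x xor z)
xor-leftComm = solve 3 (λ x y z → x :+ (y :+ z) := y :+ (x :+ z)) refl

xor-cancelˡ : ∀ x y → x xor (x xor y) ≡ y
xor-cancelˡ = solve 2 (λ x y → x :+ (x :+ y) := y) refl

xor-moveʳ : ∀ {p q r} → p xor q ≡ r → p ≡ r xor q
xor-moveʳ {p} {q} refl = solve 2 (λ p q → p := (p :+ q) :+ q) refl p q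

pattern c₁ = zero
pattern c₂ = suc zero
pattern c₃ = suc (suc zero)
pattern c₄ = suc (suc (suc zero))

module Adinkra (A : Valise41) where
  open Valise41 A

  sgn : Bool → ℤ
  sgn = sign A

  sgn-xor : ∀ s t → sgn (s xor t) ≡ sgn s * sgn t
  sgn-xor false false = refl
  sgn-xor false true  = refl
  sgn-xor true  false = refl
  sgn-xor true  true  = refl

  sgn-not : ∀ s → sgn (not s) ≡ - sgn s
  sgn-not false = refl
  sgn-not true  = refl

  fermionNbr : Color → Boson → Fermion
  fermionNbr I b = proj₁ (proj₂ (boson-colors b) I)

  bosonNbr : Color → Fermion → Boson
  bosonNbr I f = proj₁ (proj₂ (fermion-colors f) I)

  col-fermionNbr : ∀ I b → col b (fermionNbr I b) ≡ I
  col-fermionNbr I b = proj₂ (proj₂ (boson-colors b) I) refl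

  col-bosonNbr : ∀ I f → col (bosonNbr I f) f ≡ I
  col-bosonNbr I f = proj₂ (proj₂ (fermion-colors f) I) refl

  fermionNbr-unique : ∀ {I b f} → col b f ≡ I → f ≡ fermionNbr I b
  fermionNbr-unique {I} {b} e = proj₁ (boson-colors b) (trans e (sym (col-fermionNbr I b)))

  bosonNbr-unique : ∀ {I b f} → col b f ≡ I → b ≡ bosonNbr I f
  bosonNbr-unique {I} {b} {f} e = proj₁ (fermion-colors f) (trans e (sym (col-bosonNbr I f)))

  bosonNbr-fermionNbr : ∀ I b → bosonNbr I (fermionNbr I b) ≡ b
  bosonNbr-fermionNbr I b = sym (bosonNbr-unique (col-fermionNbr I b))

  fermionNbr-bosonNbr : ∀ I f → fermionNbr I (bosonNbr I f) ≡ f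
  fermionNbr-bosonNbr I f = sym (fermionNbr-unique (col-bosonNbr I f))

  L-fermionNbr : ∀ I b f → L A I b f ≡ id4 f (fermionNbr I b) * sgn (dashed b (fermionNbr I b))
  L-fermionNbr I b f with col b f ≟ I
  ... | yes e  = id4-select (λ g → sgn (dashed b g)) (fermionNbr-unique e)
  ... | no col≢I = sym (cong (_* sgn (dashed b (fermionNbr I b)))
                             (id4-off λ f≡ → col≢I (trans (cong (col b) f≡) (col-fermionNbr I b))))

  L-bosonNbr : ∀ I b f → L A I b f ≡ id4 b (bosonNbr I f) * sgn (dashed (bosonNbr I f) f)
  L-bosonNbr I b f with col b f ≟ I
  ... | yes e  = id4-select (λ c → sgn (dashed c f)) (bosonNbr-unique e)
  ... | no col≢I = sym (cong (_* sgn (dashed (bosonNbr I f) f))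
                             (id4-off λ b≡ → col≢I (trans (cong (λ c → col c f) b≡) (col-bosonNbr I f))))

  hop : Color → Idx → Idx
  hop I (inj₁ f) = inj₂ (bosonNbr I f)
  hop I (inj₂ b) = inj₁ (fermionNbr I b)

  dash : Color → Idx → Bool
  dash I (inj₁ f) = dashed (bosonNbr I f) f
  dash I (inj₂ b) = dashed b (fermionNbr I b)

  φ-monomial : ∀ I → φ A I ≋ monomial (hop I) (sgn ∘ dash I)
  φ-monomial I (inj₁ f) (inj₁ f′) = refl
  φ-monomial I (inj₁ f) (inj₂ b)  = L-fermionNbr I b f
  φ-monomial I (inj₂ b) (inj₁ f)  = L-bosonNbr I b f
  φ-monomial I (inj₂ b) (inj₂ b′) = refl

  bosonStep : Color → Color → Boson → Boson
  bosonStep I J b = bosonNbr I (fermionNbr J b)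

  bosonStep-self : ∀ I b → bosonStep I I b ≡ b
  bosonStep-self = bosonNbr-fermionNbr

  bosonStep-injective : ∀ {I J K} b → bosonStep I J b ≡ bosonStep I K b → J ≡ K
  bosonStep-injective {I} {J} {K} b e = begin
    J                               ≡⟨ sym (col-fermionNbr J b) ⟩
    col b (fermionNbr J b)          ≡⟨ cong (col b) fermionNbr≡ ⟩
    col b (fermionNbr K b)          ≡⟨ col-fermionNbr K b ⟩
    K                               ∎
    where
      open ≡-Reasoning
      fermionNbr≡ : fermionNbr J b ≡ fermionNbr K b
      fermionNbr≡ = trans (sym (fermionNbr-bosonNbr I (fermionNbr J b)))
                          (trans (cong (fermionNbr I) e) (fermionNbr-bosonNbr I (fermionNbr K b)))

  bosonStep-comm : ∀ {I J} → I ≢ J → ∀ b → bosonStep I J b ≡ bosonStep J I b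
  bosonStep-comm {I} {J} I≢J b = trans (cong (bosonNbr I) (sym fermionNbr≡)) (bosonNbr-fermionNbr I c)
    where
      c = bosonStep J I b
      closes : bosonNbr J (fermionNbr I c) ≡ b
      closes = two-color-4cycles I J I≢J b (fermionNbr I b) c (fermionNbr I c) (bosonNbr J (fermionNbr I c))
                 (col-fermionNbr I b) (col-bosonNbr J (fermionNbr I b))
                 (col-fermionNbr I c) (col-bosonNbr J (fermionNbr I c))
      fermionNbr≡ : fermionNbr I c ≡ fermionNbr J b
      fermionNbr≡ = fermionNbr-unique
                      (subst (λ d → col d (fermionNbr I c) ≡ J) closes (col-bosonNbr J (fermionNbr I c)))

  fermionStep-comm : ∀ {I J} → I ≢ J → ∀ f → fermionNbr I (bosonNbr J f) ≡ fermionNbr J (bosonNbr I f)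
  fermionStep-comm {I} {J} I≢J f = begin
    fermionNbr I (bosonNbr J f)                 ≡⟨ cong (fermionNbr I ∘ bosonNbr J) (sym (fermionNbr-bosonNbr I f)) ⟩
    fermionNbr I (bosonStep J I b)              ≡⟨ cong (fermionNbr I) (sym (bosonStep-comm I≢J b)) ⟩
    fermionNbr I (bosonNbr I (fermionNbr J b))  ≡⟨ fermionNbr-bosonNbr I (fermionNbr J b) ⟩
    fermionNbr J (bosonNbr I f)                 ∎
    where
      open ≡-Reasoning
      b = bosonNbr I f

  bosonStep-involutive : ∀ {I J} → I ≢ J → ∀ b → bosonStep I J (bosonStep I J b) ≡ b
  bosonStep-involutive {I} {J} I≢J b = begin
    bosonStep I J (bosonStep I J b)     ≡⟨ cong (bosonStep I J) (bosonStep-comm I≢J b) ⟩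
    bosonStep I J (bosonStep J I b)     ≡⟨ cong (bosonNbr I) (fermionNbr-bosonNbr J (fermionNbr I b)) ⟩
    bosonStep I I b                     ≡⟨ bosonStep-self I b ⟩
    b                                   ∎
    where open ≡-Reasoning

  -- The boson bosonStep c₃ c₄ b is joined to fermionNbr c₁ b by some colour M, so it equals
  -- bosonStep M c₁ b; injectivity of bosonStep leaves only M = c₂.
  bosonStep₃₄≡bosonStep₁₂ : ∀ b → bosonStep c₃ c₄ b ≡ bosonStep c₁ c₂ b
  bosonStep₃₄≡bosonStep₁₂ b with col (bosonStep c₃ c₄ b) (fermionNbr c₁ b) in e
  ... | c₁ = contradiction (bosonStep-injective b (trans (bosonNbr-unique e)
                             (trans (bosonStep-self c₁ b) (sym (bosonStep-self c₃ b))))) λ ()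
  ... | c₂ = trans (bosonNbr-unique e) (bosonStep-comm (λ ()) b)
  ... | c₃ = contradiction (bosonStep-injective b (bosonNbr-unique e)) λ ()
  ... | c₄ = contradiction (bosonStep-injective b (trans (bosonStep-comm (λ ()) b) (bosonNbr-unique e)))
                           λ ()

  walk : List Color → Idx → Idx
  walk []      k = k
  walk (I ∷ w) k = hop I (walk w k)

  parity : List Color → Idx → Bool
  parity []      k = false
  parity (I ∷ w) k = dash I (walk w k) xor parity w k

  ⟦_⟧ : List Color → Mat8
  ⟦ w ⟧ = monomial (walk w) (sgn ∘ parity w)

  walk-++ : ∀ u w k → walk (u ++ w) k ≡ walk u (walk w k)
  walk-++ []      w k = refl
  walk-++ (I ∷ u) w k = cong (hop I) (walk-++ u w k)

  parity-++ : ∀ u w k → parity (u ++ w) k ≡ parity u (walk w k) xor parity w k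
  parity-++ []      w k = refl
  parity-++ (I ∷ u) w k =
    trans (cong₂ (λ y p → dash I y xor p) (walk-++ u w k) (parity-++ u w k))
          (sym (xor-assoc (dash I (walk u (walk w k))) (parity u (walk w k)) (parity w k)))

  ·-⟦⟧ : ∀ {M N} u w → M ≋ ⟦ u ⟧ → N ≋ ⟦ w ⟧ → M · N ≋ ⟦ u ++ w ⟧
  ·-⟦⟧ u w M≋ N≋ = ≋-trans (·-monomial M≋ N≋) (monomial-cong (λ k → sym (walk-++ u w k)) sgn-parity)
    where
      sgn-parity : ∀ k → sgn (parity u (walk w k)) * sgn (parity w k) ≡ sgn (parity (u ++ w) k)
      sgn-parity k = trans (sym (sgn-xor (parity u (walk w k)) (parity w k)))
                           (cong sgn (sym (parity-++ u w k)))

  φ-⟦⟧ : ∀ I → φ A I ≋ ⟦ I ∷ [] ⟧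
  φ-⟦⟧ I = ≋-trans (φ-monomial I)
                   (monomial-cong (λ _ → refl) λ k → cong sgn (sym (xor-identityʳ (dash I k))))

  φ₂-⟦⟧ : ∀ I J → φ₂ A I J ≋ ⟦ I ∷ J ∷ [] ⟧
  φ₂-⟦⟧ I J = ·-⟦⟧ (I ∷ []) (J ∷ []) (φ-⟦⟧ I) (φ-⟦⟧ J)

  φ₄-⟦⟧ : ∀ I J K L → φ₄ A I J K L ≋ ⟦ I ∷ J ∷ K ∷ L ∷ [] ⟧
  φ₄-⟦⟧ I J K L =
    ·-⟦⟧ (I ∷ J ∷ K ∷ []) (L ∷ []) (·-⟦⟧ (I ∷ J ∷ []) (K ∷ []) (φ₂-⟦⟧ I J) (φ-⟦⟧ K)) (φ-⟦⟧ L)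

  φ₂-even : ∀ I J → IsEven (φ₂ A I J)
  φ₂-even I J = (λ i j → φ₂-⟦⟧ I J (inj₁ i) (inj₂ j)) , (λ i j → φ₂-⟦⟧ I J (inj₂ i) (inj₁ j))

  -- u ≃[ s ] w  says  φ_u = (-1)^s φ_w.
  record _≃[_]_ (u : List Color) (s : Bool) (w : List Color) : Set where
    field
      walk-≡   : ∀ k → walk u k ≡ walk w k
      parity-≡ : ∀ k → parity u k ≡ s xor parity w k
  open _≃[_]_

  ≃-refl : ∀ {w} → w ≃[ false ] w
  ≃-refl = record { walk-≡ = λ _ → refl ; parity-≡ = λ _ → refl }

  ≃-sym : ∀ {s u w} → u ≃[ s ] w → w ≃[ s ] u
  ≃-sym {s} r = record
    { walk-≡   = λ k → sym (walk-≡ r k)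
    ; parity-≡ = λ k → trans (sym (xor-cancelˡ s _)) (cong (s xor_) (sym (parity-≡ r k)))
    }

  ≃-trans : ∀ {s t u v w} → u ≃[ s ] v → v ≃[ t ] w → u ≃[ s xor t ] w
  ≃-trans {s} {t} r r′ = record
    { walk-≡   = λ k → trans (walk-≡ r k) (walk-≡ r′ k)
    ; parity-≡ = λ k → trans (parity-≡ r k) (trans (cong (s xor_) (parity-≡ r′ k)) (sym (xor-assoc s t _)))
    }

  ≃-prefix : ∀ {s u w} p → u ≃[ s ] w → (p ++ u) ≃[ s ] (p ++ w)
  ≃-prefix []      r = r
  ≃-prefix {s} {u} {w} (K ∷ p) r = record
    { walk-≡   = λ k → cong (hop K) (walk-≡ r′ k)
    ; parity-≡ = λ k → trans (cong₂ (λ y q → dash K y xor q) (walk-≡ r′ k) (parity-≡ r′ k))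
                              (xor-leftComm (dash K (walk (p ++ w) k)) s (parity (p ++ w) k))
    }
    where r′ = ≃-prefix p r

  ≃-suffix : ∀ {s u w} q → u ≃[ s ] w → (u ++ q) ≃[ s ] (w ++ q)
  ≃-suffix {s} {u} {w} q r = record
    { walk-≡   = λ k → trans (walk-++ u q k) (trans (walk-≡ r (walk q k)) (sym (walk-++ w q k)))
    ; parity-≡ = λ k → begin
        parity (u ++ q) k                                ≡⟨ parity-++ u q k ⟩
        parity u (walk q k) xor parity q k              ≡⟨ cong (_xor parity q k) (parity-≡ r (walk q k)) ⟩
        (s xor parity w (walk q k)) xor parity q k      ≡⟨ xor-assoc s _ _ ⟩
        s xor (parity w (walk q k) xor parity q k)      ≡⟨ cong (s xor_) (sym (parity-++ w q k)) ⟩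
        s xor parity (w ++ q) k                          ∎
    }
    where open ≡-Reasoning

  -- φ_I φ_J and φ_J φ_I carry k to the opposite corner of the I,J-coloured 4-cycle through k,
  -- along its two halves; odd dashing says that the two halves differ in parity.
  parity-anticomm : ∀ {I J} → I ≢ J → ∀ k → parity (I ∷ J ∷ []) k xor parity (J ∷ I ∷ []) k ≡ true
  parity-anticomm {I} {J} I≢J (inj₂ b) = begin
    (dashed (bosonStep I J b) f₂ xor (w xor false)) xor (y xor (x xor false))
      ≡⟨ cong (λ c → (dashed c f₂ xor (w xor false)) xor (y xor (x xor false))) (bosonStep-comm I≢J b) ⟩
    (z xor (w xor false)) xor (y xor (x xor false))
      ≡⟨ solve 4 (λ x y z w → (z :+ (w :+ con false)) :+ (y :+ (x :+ con false)) := x :+ (y :+ (z :+ w)))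
               refl x y z w ⟩
    x xor y xor z xor w
      ≡⟨ odd-dashing I J I≢J b f₁ b′ f₂
           (col-fermionNbr I b) (col-bosonNbr J f₁) col-b′f₂ (col-fermionNbr J b) ⟩
    true ∎
    where
      open ≡-Reasoning
      f₁ = fermionNbr I b
      f₂ = fermionNbr J b
      b′ = bosonStep J I b
      x = dashed b f₁
      y = dashed b′ f₁
      z = dashed b′ f₂
      w = dashed b f₂
      col-b′f₂ : col b′ f₂ ≡ I
      col-b′f₂ = subst (λ c → col c f₂ ≡ I) (bosonStep-comm I≢J b) (col-bosonNbr I f₂)
  parity-anticomm {I} {J} I≢J (inj₁ f) = begin
    (dashed b (fermionNbr I b) xor (x xor false)) xor (z xor (y xor false))
      ≡⟨ cong (λ g → (dashed b g xor (x xor false)) xor (z xor (y xor false))) (fermionStep-comm I≢J f) ⟩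
    (w xor (x xor false)) xor (z xor (y xor false))
      ≡⟨ solve 4 (λ x y z w → (w :+ (x :+ con false)) :+ (z :+ (y :+ con false)) := x :+ (y :+ (z :+ w)))
               refl x y z w ⟩
    x xor y xor z xor w
      ≡⟨ odd-dashing J I (I≢J ∘ sym) b f b′ g
           (col-bosonNbr J f) (col-bosonNbr I f) (col-fermionNbr J b′) col-bg ⟩
    true ∎
    where
      open ≡-Reasoning
      b  = bosonNbr J f
      b′ = bosonNbr I f
      g  = fermionNbr J b′
      x = dashed b f
      y = dashed b′ f
      z = dashed b′ g
      w = dashed b g
      col-bg : col b g ≡ I
      col-bg = subst (λ h → col b h ≡ I) (fermionStep-comm I≢J f) (col-fermionNbr I b)

  anticommute : ∀ I J → I ≢ J → (I ∷ J ∷ []) ≃[ true ] (J ∷ I ∷ [])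
  anticommute I J I≢J = record
    { walk-≡   = λ { (inj₁ f) → cong inj₁ (fermionStep-comm I≢J f)
                   ; (inj₂ b) → cong inj₂ (bosonStep-comm I≢J b) }
    ; parity-≡ = λ k → xor-moveʳ (parity-anticomm I≢J k)
    }

  dash-hop : ∀ I k → dash I (hop I k) ≡ dash I k
  dash-hop I (inj₁ f) = cong (dashed (bosonNbr I f)) (fermionNbr-bosonNbr I f)
  dash-hop I (inj₂ b) = cong (λ c → dashed c (fermionNbr I b)) (bosonNbr-fermionNbr I b)

  square : ∀ I → (I ∷ I ∷ []) ≃[ false ] []
  square I = record
    { walk-≡   = λ { (inj₁ f) → cong inj₁ (fermionNbr-bosonNbr I f)
                   ; (inj₂ b) → cong inj₂ (bosonNbr-fermionNbr I b) }
    ; parity-≡ = λ k → trans (cong (_xor (dash I k xor false)) (dash-hop I k))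
                             (xor-cancelˡ (dash I k) false)
    }

  exchange : ∀ I J → (I ∷ J ∷ []) ≃[ not (does (I ≟ J)) ] (J ∷ I ∷ [])
  exchange I J with I ≟ J
  ... | yes refl = ≃-refl
  ... | no  I≢J  = anticommute I J I≢J

  crossings : Color → List Color → Bool
  crossings I []      = false
  crossings I (J ∷ u) = crossings I u xor not (does (J ≟ I))

  push : ∀ I u → (u ++ I ∷ []) ≃[ crossings I u ] (I ∷ u)
  push I []      = ≃-refl
  push I (J ∷ u) = ≃-trans (≃-prefix (J ∷ []) (push I u)) (≃-suffix u (exchange J I))

  swapAt : ∀ p I J q → I ≢ J → (p ++ I ∷ J ∷ q) ≃[ true ] (p ++ J ∷ I ∷ q)
  swapAt p I J q I≢J = ≃-prefix p (≃-suffix q (anticommute I J I≢J))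

  cancelAt : ∀ p I q → (p ++ I ∷ I ∷ q) ≃[ false ] (p ++ q)
  cancelAt p I q = ≃-prefix p (≃-suffix q (square I))

  module ≃-Reasoning where
    infixr 2 _≃⟨_⟩_
    infix  3 _∎

    _≃⟨_⟩_ : ∀ u {s t v w} → u ≃[ s ] v → v ≃[ t ] w → u ≃[ s xor t ] w
    u ≃⟨ r ⟩ r′ = ≃-trans r r′

    _∎ : ∀ w → w ≃[ false ] w
    w ∎ = ≃-refl

  ≃⁺⇒≋ : ∀ {u w} → u ≃[ false ] w → ⟦ u ⟧ ≋ ⟦ w ⟧
  ≃⁺⇒≋ r = monomial-cong (walk-≡ r) (λ k → cong sgn (parity-≡ r k))

  ≃⁻⇒≋ : ∀ {u w} → u ≃[ true ] w → ⟦ u ⟧ ≋ neg ⟦ w ⟧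
  ≃⁻⇒≋ {u} {w} r =
    ≋-trans (monomial-cong (walk-≡ r) λ k → trans (cong sgn (parity-≡ r k)) (sgn-not (parity w k)))
            (monomial-neg (walk w) (sgn ∘ parity w))

  w₁₂₃₄ : List Color
  w₁₂₃₄ = c₁ ∷ c₂ ∷ c₃ ∷ c₄ ∷ []

  φ₁₂₃₄-anticomm : ∀ I → (w₁₂₃₄ ++ I ∷ []) ≃[ true ] (I ∷ w₁₂₃₄)
  φ₁₂₃₄-anticomm I = subst (λ s → (w₁₂₃₄ ++ I ∷ []) ≃[ s ] (I ∷ w₁₂₃₄)) (odd I) (push I w₁₂₃₄)
    where
      odd : ∀ I → crossings I w₁₂₃₄ ≡ true
      odd c₁ = refl
      odd c₂ = refl
      odd c₃ = refl
      odd c₄ = refl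

  walk₁₂₃₄ : ∀ k → walk w₁₂₃₄ k ≡ k
  walk₁₂₃₄ (inj₂ b) =
    cong inj₂ (trans (cong (bosonStep c₁ c₂) (bosonStep₃₄≡bosonStep₁₂ b)) (bosonStep-involutive (λ ()) b))
  walk₁₂₃₄ (inj₁ f) = begin
    walk w₁₂₃₄ (inj₁ f)                  ≡⟨ cong (walk w₁₂₃₄ ∘ inj₁) (sym (fermionNbr-bosonNbr c₄ f)) ⟩
    walk w₁₂₃₄ (hop c₄ (inj₂ b))         ≡⟨ walk-≡ (φ₁₂₃₄-anticomm c₄) (inj₂ b) ⟩
    hop c₄ (walk w₁₂₃₄ (inj₂ b))         ≡⟨ cong (hop c₄) (walk₁₂₃₄ (inj₂ b)) ⟩
    hop c₄ (inj₂ b)                      ≡⟨ cong inj₁ (fermionNbr-bosonNbr c₄ f) ⟩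
    inj₁ f                               ∎
    where
      open ≡-Reasoning
      b = bosonNbr c₄ f

  chirality : Idx → Bool
  chirality = parity w₁₂₃₄

  chirality-hop : ∀ I k → chirality (hop I k) ≡ not (chirality k)
  chirality-hop I k = begin
    chirality (hop I k)
      ≡⟨ xor-moveʳ (sym (parity-++ w₁₂₃₄ (I ∷ []) k)) ⟩
    parity (w₁₂₃₄ ++ I ∷ []) k xor (d xor false)
      ≡⟨ cong (_xor (d xor false)) (parity-≡ (φ₁₂₃₄-anticomm I) k) ⟩
    (true xor (dash I (walk w₁₂₃₄ k) xor chirality k)) xor (d xor false)
      ≡⟨ cong (λ y → (true xor (dash I y xor chirality k)) xor (d xor false)) (walk₁₂₃₄ k) ⟩
    (true xor (d xor chirality k)) xor (d xor false)
      ≡⟨ solve 2 (λ d c → (con true :+ (d :+ c)) :+ (d :+ con false) := con true :+ c) refl d (chirality k) ⟩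
    not (chirality k)
      ∎
    where
      open ≡-Reasoning
      d = dash I k

  chirality-boson : ∀ b → chirality (inj₂ b) ≡ chirality (inj₂ zero)
  chirality-boson b = begin
    chirality (inj₂ b)                                   ≡⟨ cong (chirality ∘ inj₂) (bosonNbr-unique refl) ⟩
    chirality (hop I (hop c₁ (inj₂ zero)))               ≡⟨ chirality-hop I (hop c₁ (inj₂ zero)) ⟩
    not (chirality (hop c₁ (inj₂ zero)))                 ≡⟨ cong not (chirality-hop c₁ (inj₂ zero)) ⟩
    not (not (chirality (inj₂ zero)))                    ≡⟨ not-involutive _ ⟩
    chirality (inj₂ zero)                                ∎
    where
      open ≡-Reasoning
      I = col b (fermionNbr c₁ zero)

  χ₀-chirality : χ₀ A ≡ sgn (chirality (inj₂ zero))
  χ₀-chirality = trans (φ₄-⟦⟧ c₁ c₂ c₃ c₄ (inj₂ zero) (inj₂ zero))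
                 (trans (cong (λ y → δ (inj₂ zero) y * sgn (chirality (inj₂ zero))) (walk₁₂₃₄ (inj₂ zero)))
                        (*-identityˡ (sgn (chirality (inj₂ zero)))))

  sgn-chirality-boson : ∀ b → sgn (chirality (inj₂ b)) ≡ χ₀ A
  sgn-chirality-boson b = trans (cong sgn (chirality-boson b)) (sym χ₀-chirality)

  sgn-chirality-fermion : ∀ f → sgn (chirality (inj₁ f)) ≡ - χ₀ A
  sgn-chirality-fermion f = begin
    sgn (chirality (inj₁ f))                   ≡⟨ cong (sgn ∘ chirality ∘ inj₁) (sym (fermionNbr-bosonNbr c₁ f)) ⟩
    sgn (chirality (hop c₁ (inj₂ b)))          ≡⟨ cong sgn (chirality-hop c₁ (inj₂ b)) ⟩
    sgn (not (chirality (inj₂ b)))             ≡⟨ sgn-not _ ⟩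
    - sgn (chirality (inj₂ b))                 ≡⟨ cong -_ (sgn-chirality-boson b) ⟩
    - χ₀ A                                     ∎
    where
      open ≡-Reasoning
      b = bosonNbr c₁ f

  χ₀-unit : χ₀ A ≡ 1ℤ ⊎ χ₀ A ≡ -1ℤ
  χ₀-unit = subst (λ x → x ≡ 1ℤ ⊎ x ≡ -1ℤ) (sym χ₀-chirality) (sgn-unit (chirality (inj₂ zero)))
    where
      sgn-unit : ∀ s → sgn s ≡ 1ℤ ⊎ sgn s ≡ -1ℤ
      sgn-unit false = inj₁ refl
      sgn-unit true  = inj₂ refl

  Γ : Mat8
  Γ = blockDiag (scale4 (- χ₀ A) id4) (scale4 (χ₀ A) id4)

  ⟦w₁₂₃₄⟧-diagonal : ⟦ w₁₂₃₄ ⟧ ≋ Γ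
  ⟦w₁₂₃₄⟧-diagonal = monomial-blockDiag (- χ₀ A) (χ₀ A) walk₁₂₃₄ sgn-chirality-fermion sgn-chirality-boson

  IJKL≃KLIJ : ∀ {I J K L} → I ≢ K → I ≢ L → J ≢ K → J ≢ L →
              (I ∷ J ∷ K ∷ L ∷ []) ≃[ false ] (K ∷ L ∷ I ∷ J ∷ [])
  IJKL≃KLIJ {I} {J} {K} {L} I≢K I≢L J≢K J≢L =
    I ∷ J ∷ K ∷ L ∷ [] ≃⟨ swapAt (I ∷ []) J K (L ∷ []) J≢K ⟩
    I ∷ K ∷ J ∷ L ∷ [] ≃⟨ swapAt [] I K (J ∷ L ∷ []) I≢K ⟩
    K ∷ I ∷ J ∷ L ∷ [] ≃⟨ swapAt (K ∷ I ∷ []) J L [] J≢L ⟩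
    K ∷ I ∷ L ∷ J ∷ [] ≃⟨ swapAt (K ∷ []) I L (J ∷ []) I≢L ⟩
    K ∷ L ∷ I ∷ J ∷ [] ∎
    where open ≃-Reasoning

  φ₂-comm : ∀ {I J K L} → I ≢ K → I ≢ L → J ≢ K → J ≢ L →
            φ₂ A I J · φ₂ A K L ≋ φ₂ A K L · φ₂ A I J
  φ₂-comm {I} {J} {K} {L} I≢K I≢L J≢K J≢L = begin
    φ₂ A I J · φ₂ A K L       ≈⟨ ·-⟦⟧ (I ∷ J ∷ []) (K ∷ L ∷ []) (φ₂-⟦⟧ I J) (φ₂-⟦⟧ K L) ⟩
    ⟦ I ∷ J ∷ K ∷ L ∷ [] ⟧    ≈⟨ ≃⁺⇒≋ (IJKL≃KLIJ I≢K I≢L J≢K J≢L) ⟩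
    ⟦ K ∷ L ∷ I ∷ J ∷ [] ⟧    ≈⟨ ·-⟦⟧ (K ∷ L ∷ []) (I ∷ J ∷ []) (φ₂-⟦⟧ K L) (φ₂-⟦⟧ I J) ⟨
    φ₂ A K L · φ₂ A I J       ∎
    where open SetoidReasoning ≋-setoid

  1324≃1234 : (c₁ ∷ c₃ ∷ c₂ ∷ c₄ ∷ []) ≃[ true ] w₁₂₃₄
  1324≃1234 = swapAt (c₁ ∷ []) c₃ c₂ (c₄ ∷ []) (λ ())

  1423≃1234 : (c₁ ∷ c₄ ∷ c₂ ∷ c₃ ∷ []) ≃[ false ] w₁₂₃₄
  1423≃1234 =
    c₁ ∷ c₄ ∷ c₂ ∷ c₃ ∷ [] ≃⟨ swapAt (c₁ ∷ []) c₄ c₂ (c₃ ∷ []) (λ ()) ⟩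
    c₁ ∷ c₂ ∷ c₄ ∷ c₃ ∷ [] ≃⟨ swapAt (c₁ ∷ c₂ ∷ []) c₄ c₃ [] (λ ()) ⟩
    c₁ ∷ c₂ ∷ c₃ ∷ c₄ ∷ [] ∎
    where open ≃-Reasoning

  1234·34≃12 : (w₁₂₃₄ ++ c₃ ∷ c₄ ∷ []) ≃[ true ] (c₁ ∷ c₂ ∷ [])
  1234·34≃12 =
    c₁ ∷ c₂ ∷ c₃ ∷ c₄ ∷ c₃ ∷ c₄ ∷ [] ≃⟨ swapAt (c₁ ∷ c₂ ∷ c₃ ∷ []) c₄ c₃ (c₄ ∷ []) (λ ()) ⟩
    c₁ ∷ c₂ ∷ c₃ ∷ c₃ ∷ c₄ ∷ c₄ ∷ [] ≃⟨ cancelAt (c₁ ∷ c₂ ∷ c₃ ∷ c₃ ∷ []) c₄ [] ⟩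
    c₁ ∷ c₂ ∷ c₃ ∷ c₃ ∷ []           ≃⟨ cancelAt (c₁ ∷ c₂ ∷ []) c₃ [] ⟩
    c₁ ∷ c₂ ∷ []                     ∎
    where open ≃-Reasoning

  1234·24≃13 : (w₁₂₃₄ ++ c₂ ∷ c₄ ∷ []) ≃[ false ] (c₁ ∷ c₃ ∷ [])
  1234·24≃13 =
    c₁ ∷ c₂ ∷ c₃ ∷ c₄ ∷ c₂ ∷ c₄ ∷ [] ≃⟨ swapAt (c₁ ∷ c₂ ∷ c₃ ∷ []) c₄ c₂ (c₄ ∷ []) (λ ()) ⟩
    c₁ ∷ c₂ ∷ c₃ ∷ c₂ ∷ c₄ ∷ c₄ ∷ [] ≃⟨ cancelAt (c₁ ∷ c₂ ∷ c₃ ∷ c₂ ∷ []) c₄ [] ⟩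
    c₁ ∷ c₂ ∷ c₃ ∷ c₂ ∷ []           ≃⟨ swapAt (c₁ ∷ c₂ ∷ []) c₃ c₂ [] (λ ()) ⟩
    c₁ ∷ c₂ ∷ c₂ ∷ c₃ ∷ []           ≃⟨ cancelAt (c₁ ∷ []) c₂ (c₃ ∷ []) ⟩
    c₁ ∷ c₃ ∷ []                     ∎
    where open ≃-Reasoning

  1234·23≃14 : (w₁₂₃₄ ++ c₂ ∷ c₃ ∷ []) ≃[ true ] (c₁ ∷ c₄ ∷ [])
  1234·23≃14 =
    c₁ ∷ c₂ ∷ c₃ ∷ c₄ ∷ c₂ ∷ c₃ ∷ [] ≃⟨ swapAt (c₁ ∷ c₂ ∷ c₃ ∷ []) c₄ c₂ (c₃ ∷ []) (λ ()) ⟩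
    c₁ ∷ c₂ ∷ c₃ ∷ c₂ ∷ c₄ ∷ c₃ ∷ [] ≃⟨ swapAt (c₁ ∷ c₂ ∷ []) c₃ c₂ (c₄ ∷ c₃ ∷ []) (λ ()) ⟩
    c₁ ∷ c₂ ∷ c₂ ∷ c₃ ∷ c₄ ∷ c₃ ∷ [] ≃⟨ cancelAt (c₁ ∷ []) c₂ (c₃ ∷ c₄ ∷ c₃ ∷ []) ⟩
    c₁ ∷ c₃ ∷ c₄ ∷ c₃ ∷ []           ≃⟨ swapAt (c₁ ∷ c₃ ∷ []) c₄ c₃ [] (λ ()) ⟩
    c₁ ∷ c₃ ∷ c₃ ∷ c₄ ∷ []           ≃⟨ cancelAt (c₁ ∷ []) c₃ (c₄ ∷ []) ⟩
    c₁ ∷ c₄ ∷ []                     ∎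
    where open ≃-Reasoning

  φ₁₂₃₄-diagonal : φ₄ A c₁ c₂ c₃ c₄ ≋ Γ
  φ₁₂₃₄-diagonal = ≋-trans (φ₄-⟦⟧ c₁ c₂ c₃ c₄) ⟦w₁₂₃₄⟧-diagonal

  φ₁₃₂₄-diagonal : neg (φ₄ A c₁ c₃ c₂ c₄) ≋ Γ
  φ₁₃₂₄-diagonal = begin
    neg (φ₄ A c₁ c₃ c₂ c₄)          ≈⟨ neg-cong (φ₄-⟦⟧ c₁ c₃ c₂ c₄) ⟩
    neg ⟦ c₁ ∷ c₃ ∷ c₂ ∷ c₄ ∷ [] ⟧   ≈⟨ ≃⁻⇒≋ (≃-sym 1324≃1234) ⟨
    ⟦ w₁₂₃₄ ⟧                       ≈⟨ ⟦w₁₂₃₄⟧-diagonal ⟩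
    Γ                               ∎
    where open SetoidReasoning ≋-setoid

  φ₁₄₂₃-diagonal : φ₄ A c₁ c₄ c₂ c₃ ≋ Γ
  φ₁₄₂₃-diagonal = ≋-trans (φ₄-⟦⟧ c₁ c₄ c₂ c₃) (≋-trans (≃⁺⇒≋ 1423≃1234) ⟦w₁₂₃₄⟧-diagonal)

  φ₁₂₃₄-· : ∀ M → IsEven M → φ₄ A c₁ c₂ c₃ c₄ · M ≋ scaleBlocks (- χ₀ A) (χ₀ A) M
  φ₁₂₃₄-· M M-even = ≋-trans (·-cong {N = M} {N′ = M} φ₁₂₃₄-diagonal ≋-refl)
                             (blockDiag-scalar-· (- χ₀ A) (χ₀ A) M M-even)

  φ₂-via-φ₁₂₃₄⁺ : ∀ {I J K L} → (w₁₂₃₄ ++ K ∷ L ∷ []) ≃[ false ] (I ∷ J ∷ []) →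
                  φ₂ A I J ≋ scaleBlocks (- χ₀ A) (χ₀ A) (φ₂ A K L)
  φ₂-via-φ₁₂₃₄⁺ {I} {J} {K} {L} r = begin
    φ₂ A I J                            ≈⟨ φ₂-⟦⟧ I J ⟩
    ⟦ I ∷ J ∷ [] ⟧                      ≈⟨ ≃⁺⇒≋ r ⟨
    ⟦ w₁₂₃₄ ++ K ∷ L ∷ [] ⟧             ≈⟨ ·-⟦⟧ w₁₂₃₄ (K ∷ L ∷ []) (φ₄-⟦⟧ c₁ c₂ c₃ c₄) (φ₂-⟦⟧ K L) ⟨
    φ₄ A c₁ c₂ c₃ c₄ · φ₂ A K L         ≈⟨ φ₁₂₃₄-· (φ₂ A K L) (φ₂-even K L) ⟩
    scaleBlocks (- χ₀ A) (χ₀ A) (φ₂ A K L) ∎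
    where open SetoidReasoning ≋-setoid

  φ₂-via-φ₁₂₃₄⁻ : ∀ {I J K L} → (w₁₂₃₄ ++ K ∷ L ∷ []) ≃[ true ] (I ∷ J ∷ []) →
                  φ₂ A I J ≋ scaleBlocks (χ₀ A) (- χ₀ A) (φ₂ A K L)
  φ₂-via-φ₁₂₃₄⁻ {I} {J} {K} {L} r = begin
    φ₂ A I J                                     ≈⟨ φ₂-⟦⟧ I J ⟩
    ⟦ I ∷ J ∷ [] ⟧                               ≈⟨ ≃⁻⇒≋ (≃-sym r) ⟩
    neg ⟦ w₁₂₃₄ ++ K ∷ L ∷ [] ⟧
      ≈⟨ neg-cong (·-⟦⟧ w₁₂₃₄ (K ∷ L ∷ []) (φ₄-⟦⟧ c₁ c₂ c₃ c₄) (φ₂-⟦⟧ K L)) ⟨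
    neg (φ₄ A c₁ c₂ c₃ c₄ · φ₂ A K L)            ≈⟨ neg-cong (φ₁₂₃₄-· (φ₂ A K L) (φ₂-even K L)) ⟩
    neg (scaleBlocks (- χ₀ A) (χ₀ A) (φ₂ A K L)) ≈⟨ neg-scaleBlocks (χ₀ A) (χ₀ A) (φ₂ A K L) ⟩
    scaleBlocks (χ₀ A) (- χ₀ A) (φ₂ A K L)       ∎
    where open SetoidReasoning ≋-setoid

open Adinkra using (φ₂-comm; χ₀-unit; φ₁₂₃₄-diagonal; φ₁₃₂₄-diagonal; φ₁₄₂₃-diagonal;
                    φ₂-via-φ₁₂₃₄⁺; φ₂-via-φ₁₂₃₄⁻; 1234·34≃12; 1234·24≃13; 1234·23≃14)

corollary3p3 : (A : Valise41) →
    -- (1)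
    (∀ (I J K L : Fin 4) → ¬ (I ≡ J) → ¬ (I ≡ K) → ¬ (I ≡ L) → ¬ (J ≡ K) → ¬ (J ≡ L) → ¬ (K ≡ L) →
      φ₂ A I J · φ₂ A K L ≋ φ₂ A K L · φ₂ A I J)
    -- (2)
    × (χ₀ A ≡ 1ℤ ⊎ χ₀ A ≡ -1ℤ)
    × (φ₄ A zero (suc zero) (suc (suc zero)) (suc (suc (suc zero)))
        ≋ blockDiag (scale4 (- χ₀ A) id4) (scale4 (χ₀ A) id4))
    × (neg (φ₄ A zero (suc (suc zero)) (suc zero) (suc (suc (suc zero))))
        ≋ blockDiag (scale4 (- χ₀ A) id4) (scale4 (χ₀ A) id4))
    × (φ₄ A zero (suc (suc (suc zero))) (suc zero) (suc (suc zero))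
        ≋ blockDiag (scale4 (- χ₀ A) id4) (scale4 (χ₀ A) id4))
    -- (3)
    × (φ₂ A zero (suc zero)
        ≋ blockDiag (scale4 (χ₀ A) (φ₂ A (suc (suc zero)) (suc (suc (suc zero))) |F))
                    (scale4 (- χ₀ A) (φ₂ A (suc (suc zero)) (suc (suc (suc zero))) |B)))
    -- (4)
    × (φ₂ A zero (suc (suc zero))
        ≋ blockDiag (scale4 (- χ₀ A) (φ₂ A (suc zero) (suc (suc (suc zero))) |F))
                    (scale4 (χ₀ A) (φ₂ A (suc zero) (suc (suc (suc zero))) |B)))
    -- (5)
    × (φ₂ A zero (suc (suc (suc zero)))
        ≋ blockDiag (scale4 (χ₀ A) (φ₂ A (suc zero) (suc (suc zero)) |F))
                    (scale4 (- χ₀ A) (φ₂ A (suc zero) (suc (suc zero)) |B)))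
corollary3p3 A =
    (λ I J K L _ I≢K I≢L J≢K J≢L _ → φ₂-comm A I≢K I≢L J≢K J≢L)
  , χ₀-unit A
  , φ₁₂₃₄-diagonal A
  , φ₁₃₂₄-diagonal A
  , φ₁₄₂₃-diagonal A
  , φ₂-via-φ₁₂₃₄⁻ A (1234·34≃12 A)
  , φ₂-via-φ₁₂₃₄⁺ A (1234·24≃13 A)
  , φ₂-via-φ₁₂₃₄⁻ A (1234·23≃14 A)
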